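{- Let $G_1,\ldots,G_k$ be pairwise disjoint connected graphs and $x_i,y_i\in V(G_i)$ for $i\in[k]$. Let $G$ be the link of $G_1,\ldots,G_k$ with respect to $\{x_i,y_i\}$, i.e. the graph obtained from the disjoint union of the $G_i$ by adding an edge between $y_i$ and $x_{i+1}$ for each $i\in[k-1]$. Put $d_l=d_{G_l}(x_l,y_l)$ and, for $1\le i<j\le k$, $s_{i,j}=d_{i+1}+d_{i+2}+\cdots+d_{j-1}$ if $j-i\ge 2$ and $s_{i,j}=0$ otherwise. Then $$H(G,t)=\sum_{i=1}^k H(G_i,t)+\sum_{1\le i<j\le k}\bigl(1+H_{y_i}(G_i,t)\bigr)\bigl(1+H_{x_j}(G_j,t)\bigr)\,t^{\,j-i+s_{i,j}}.$$
   Context: All graphs are finite, simple and connected; $d_G(u,v)$ denotes shortest-path distance. $[k]=\{1,\ldots,k\}$. The Hosoya polynomial is $H(G,t)=\sum_{\{u,v\}\subseteq V(G),\,u\ne v} t^{d_G(u,v)}$ (no constant term), and for $u\in V(G)$ the partial Hosoya polynomial is $H_u(G,t)=\sum_{v\in V(G),v\ne u} t^{d_G(u,v)}$. -}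

module Defs where

open import Data.Nat using (ℕ; zero; suc; _+_; _*_; _∸_; _<_; _≤ᵇ_; _<ᵇ_; _≡ᵇ_)
open import Data.Bool using (Bool; true; false; _∧_; _∨_; if_then_else_)
open import Data.List using (List; []; _∷_; map; _++_; length; upTo; allFin; concatMap; foldr)
open import Data.Bool.ListAction using (any)
open import Data.List.Membership.Propositional using (_∈_)
open import Data.List.Relation.Unary.Unique.Propositional using (Unique)
open import Data.Fin using (Fin; toℕ) renaming (_≟_ to _≟F_)
open import Data.Product using (Σ; _×_; _,_; ∃-syntax)
open import Relation.Nullary using (yes; no; Dec)
open import Relation.Nullary.Decidable using (isYes)
open import Relation.Binary.PropositionalEquality using (_≡_; refl; cong)
open import Relation.Binary.Definitions using (DecidableEquality)

record Graph : Set₁ where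
  field
    V     : Set
    _≟_   : DecidableEquality V
    verts : List V
    adj   : V → V → Bool
open Graph public

WellFormed : Graph → Set
WellFormed G =
  (∀ v → v ∈ verts G) × Unique (verts G) ×
  (∀ u v → adj G u v ≡ adj G v u) × (∀ v → adj G v v ≡ false)

-- reach G m u v = true  iff there is a walk from u to v of length ≤ m.
reach : (G : Graph) → ℕ → V G → V G → Bool
reach G zero    u v = isYes (_≟_ G u v)
reach G (suc m) u v = isYes (_≟_ G u v) ∨ any (λ w → adj G u w ∧ reach G m w v) (verts G)

Connected : Graph → Set
Connected G = ∀ u v → ∃[ m ] (reach G m u v ≡ true)

firstTrue : (ℕ → Bool) → ℕ → ℕ → ℕ
firstTrue f i zero = i
firstTrue f i (suc fuel) = if f i then i else firstTrue f (suc i) fuel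

-- shortest-path distance: least m such that a walk of length ≤ m exists
-- (for connected graphs this is found among 0 … |V|)
dist : (G : Graph) → V G → V G → ℕ
dist G u v = firstTrue (λ m → reach G m u v) 0 (length (verts G))

pairs : {A : Set} → List A → List (A × A)
pairs []       = []
pairs (x ∷ xs) = map (x ,_) xs ++ pairs xs

count : {A : Set} → (A → Bool) → List A → ℕ
count p = foldr (λ a n → if p a then suc n else n) 0

sumL : {A : Set} → (A → ℕ) → List A → ℕ
sumL f = foldr (λ a n → f a + n) 0

-- Polynomials with natural coefficients, as coefficient functions
Poly : Set
Poly = ℕ → ℕ

_⊕_ : Poly → Poly → Poly
(p ⊕ q) d = p d + q d

_⊗_ : Poly → Poly → Poly
(p ⊗ q) d = sumL (λ a → p a * q (d ∸ a)) (upTo (suc d))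

one : Poly
one zero    = 1
one (suc _) = 0

tpow* : ℕ → Poly → Poly
tpow* m p d = if m ≤ᵇ d then p (d ∸ m) else 0

sumP : {A : Set} → (A → Poly) → List A → Poly
sumP f xs d = sumL (λ a → f a d) xs

-- Hosoya polynomial: coefficient of t^d = #unordered pairs {u,v}, u ≠ v,
-- at distance d
Hosoya : Graph → Poly
Hosoya G d = count (λ uv → dist G (Data.Product.proj₁ uv) (Data.Product.proj₂ uv) ≡ᵇ d) (pairs (verts G))

HosoyaAt : (G : Graph) → V G → Poly
HosoyaAt G u d = count (λ v → (Data.Bool.not (isYes (_≟_ G u v))) ∧ (dist G u v ≡ᵇ d)) (verts G)

-- The link of G_0,…,G_{k-1} (0-indexed) w.r.t. {x_i , y_i}: disjoint union
-- plus edges y_i ~ x_{i+1}.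
module _ (k : ℕ) (Gs : Fin k → Graph) (x y : (i : Fin k) → V (Gs i)) where

  LV : Set
  LV = Σ (Fin k) (λ i → V (Gs i))

  LV≟ : DecidableEquality LV
  LV≟ (i , a) (j , b) with i ≟F j
  ... | no i≢j = no (λ eq → i≢j (cong Data.Product.proj₁ eq))
  ... | yes refl with _≟_ (Gs i) a b
  ...   | yes refl = yes refl
  ...   | no a≢b = no (λ { refl → a≢b refl })

  linkAdj : LV → LV → Bool
  linkAdj (i , a) (j , b) with i ≟F j
  ... | yes refl = adj (Gs i) a b
  ... | no _ =
        ((toℕ j ≡ᵇ suc (toℕ i)) ∧ isYes (_≟_ (Gs i) a (y i)) ∧ isYes (_≟_ (Gs j) b (x j)))
      ∨ ((toℕ i ≡ᵇ suc (toℕ j)) ∧ isYes (_≟_ (Gs i) a (x i)) ∧ isYes (_≟_ (Gs j) b (y j)))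

  link : Graph
  link = record
    { V     = LV
    ; _≟_   = LV≟
    ; verts = concatMap (λ i → map (i ,_) (verts (Gs i))) (allFin k)
    ; adj   = linkAdj
    }

  dd : Fin k → ℕ
  dd l = dist (Gs l) (x l) (y l)

  s : Fin k → Fin k → ℕ
  s i j = sumL (λ l → if (toℕ i <ᵇ toℕ l) ∧ (toℕ l <ᵇ toℕ j) then dd l else 0) (allFin k)

  -- right-hand side of the formula; pairs (allFin k) enumerates all i < j
  linkRHS : Poly
  linkRHS =
    sumP (λ i → Hosoya (Gs i)) (allFin k) ⊕
    sumP (λ ij → let i = Data.Product.proj₁ ij ; j = Data.Product.proj₂ ij in
            tpow* (toℕ j ∸ toℕ i + s i j)
              ((one ⊕ HosoyaAt (Gs i) (y i)) ⊗ (one ⊕ HosoyaAt (Gs j) (x j))))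
         (pairs (allFin k))

module Submission where

-- The argument is a computation of the distances in the link G: for a in G_i and
-- b in G_j with i < j
--     d_G(a , b) = d_{G_i}(a , y_i) + (j - i + s_{i,j}) + d_{G_j}(x_j , b),
-- and inside a block d_G is the distance of the block.  Writing D for this formula,
-- D ≤ d_G because D vanishes on the diagonal and changes by at most one along each
-- edge of G, and d_G ≤ D because geodesics of the blocks joined by the bridge
-- edges form a walk of length D.  Counting the pairs at distance d block by block
-- then yields the coefficient of t^d: pairs inside G_i contribute H(G_i), and pairs
-- across G_i , G_j are counted by the product (1 + H_{y_i}(G_i)) (1 + H_{x_j}(G_j))
-- shifted by t^{j-i+s_{i,j}}.

open import Defs
open import Data.Nat using (ℕ; zero; suc; _+_; _*_; _∸_; _≤_; _<_; z≤n; s≤s; _≤ᵇ_; _<ᵇ_; _≡ᵇ_)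
open import Data.Nat.Properties hiding (_≟_)
open import Data.Nat.Tactic.RingSolver using (solve-∀)
open import Data.Bool using (Bool; true; false; _∧_; _∨_; if_then_else_; not; T)
open import Data.Bool.Properties using (∨-zeroʳ; T-≡)
open import Data.Unit using (tt)
open import Data.List using (List; []; _∷_; map; _++_; length; upTo; allFin; concatMap)
open import Data.Bool.ListAction using (any)
open import Data.List.Membership.Propositional using (_∈_; find; lose)
open import Data.List.Membership.Propositional.Properties
  using (∈-map⁺; ∈-allFin; ∈-concatMap⁺; ∈-upTo⁺; ∈-upTo⁻)
open import Data.List.Relation.Unary.Any using (here; there)
open import Data.List.Relation.Unary.Any.Properties using (any⁺; any⁻)
import Data.List.Relation.Unary.All as All
open import Data.List.Relation.Unary.AllPairs using (AllPairs; []; _∷_)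
open import Data.List.Relation.Unary.Unique.Propositional using (Unique)
open import Data.List.Relation.Unary.Unique.Propositional.Properties using (allFin⁺; upTo⁺)
open import Data.List.Relation.Unary.AllPairs.Properties using (tabulate⁺-<)
open import Data.Fin using (Fin; toℕ; fromℕ<) renaming (_≟_ to _≟F_; _<_ to _<F_)
open import Data.Fin.Properties using (toℕ-injective; toℕ-fromℕ<; toℕ<n) renaming (<-cmp to <-cmpF)
open import Data.List.Relation.Unary.All.Properties.Core using (¬Any⇒All¬)
import Data.List.Membership.DecPropositional as DecMem
open import Data.Product using (Σ; _×_; _,_; ∃-syntax; proj₁; proj₂)
open import Data.Sum using (_⊎_; inj₁; inj₂)
open import Data.Empty using (⊥; ⊥-elim)
open import Function.Bundles using (Equivalence)
open import Relation.Nullary using (yes; no; Dec; ¬_)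
open import Relation.Nullary.Decidable using (isYes)
open import Relation.Binary.PropositionalEquality
open import Relation.Binary.Definitions using (DecidableEquality; tri<; tri≈; tri>)

T-true : ∀ {b} → T b → b ≡ true
T-true = Equivalence.to T-≡

true-T : ∀ {b} → b ≡ true → T b
true-T = Equivalence.from T-≡

T-false : ∀ {b} → ¬ T b → b ≡ false
T-false {false} _ = refl
T-false {true}  h = ⊥-elim (h tt)

T-ext : ∀ {b₁ b₂ : Bool} → (T b₁ → T b₂) → (T b₂ → T b₁) → b₁ ≡ b₂
T-ext {false} {false} _ _ = refl
T-ext {false} {true}  _ g = ⊥-elim (g tt)
T-ext {true}  {false} f _ = ⊥-elim (f tt)
T-ext {true}  {true}  _ _ = refl

∧-true : ∀ {a b : Bool} → (a ∧ b) ≡ true → a ≡ true × b ≡ true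
∧-true {true} {true} _ = refl , refl

∨-true : ∀ {a b : Bool} → (a ∨ b) ≡ true → a ≡ true ⊎ b ≡ true
∨-true {true}  _ = inj₁ refl
∨-true {false} h = inj₂ h

≡ᵇ-true : ∀ m n → m ≡ n → (m ≡ᵇ n) ≡ true
≡ᵇ-true m n e = T-true (≡⇒≡ᵇ m n e)

≡ᵇ-false : ∀ m n → ¬ m ≡ n → (m ≡ᵇ n) ≡ false
≡ᵇ-false m n ne = T-false (λ t → ne (≡ᵇ⇒≡ m n t))

<ᵇ-true : ∀ m n → m < n → (m <ᵇ n) ≡ true
<ᵇ-true m n lt = T-true (<⇒<ᵇ lt)

<ᵇ-false : ∀ m n → ¬ m < n → (m <ᵇ n) ≡ false
<ᵇ-false m n ne = T-false (λ t → ne (<ᵇ⇒< m n t))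

isYes-true : ∀ {A : Set} (d : Dec A) → isYes d ≡ true → A
isYes-true (yes p) _ = p

isYes-false : ∀ {A : Set} → ¬ A → (d : Dec A) → isYes d ≡ false
isYes-false ¬a (yes a) = ⊥-elim (¬a a)
isYes-false ¬a (no _)  = refl

isYes-refl : ∀ {A : Set} (_≟A_ : DecidableEquality A) a → isYes (a ≟A a) ≡ true
isYes-refl _≟A_ a with a ≟A a
... | yes _  = refl
... | no a≢a = ⊥-elim (a≢a refl)

any-witness : ∀ {A : Set} (p : A → Bool) xs → any p xs ≡ true → ∃[ a ] (a ∈ xs × p a ≡ true)
any-witness p xs h with find (any⁻ p xs (true-T h))
... | a , a∈xs , pa = a , a∈xs , T-true pa

any-intro : ∀ {A : Set} (p : A → Bool) {xs a} → a ∈ xs → p a ≡ true → any p xs ≡ true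
any-intro p a∈xs pa = T-true (any⁺ p (lose a∈xs (true-T pa)))

-- Pigeonhole for lists: a duplicate-free list contained in ys is no longer than ys.
-- It bounds the length of a walk without repeated vertices by the number of vertices.

remove : ∀ {A : Set} {x : A} ys → x ∈ ys → List A
remove (_ ∷ ys) (here _)  = ys
remove (y ∷ ys) (there p) = y ∷ remove ys p

length-remove : ∀ {A : Set} {x : A} ys (p : x ∈ ys) → length ys ≡ suc (length (remove ys p))
length-remove (_ ∷ ys) (here _)  = refl
length-remove (_ ∷ ys) (there p) = cong suc (length-remove ys p)

∈-remove : ∀ {A : Set} {x z : A} ys (p : x ∈ ys) → z ∈ ys → z ≢ x → z ∈ remove ys p
∈-remove (_ ∷ ys) (here refl) (here z≡x) z≢x = ⊥-elim (z≢x z≡x)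
∈-remove (_ ∷ ys) (here refl) (there q)  _   = q
∈-remove (_ ∷ ys) (there p)   (here z≡y) _   = here z≡y
∈-remove (_ ∷ ys) (there p)   (there q)  z≢x = there (∈-remove ys p q z≢x)

unique-length≤ : ∀ {A : Set} (xs ys : List A) → Unique xs → (∀ {z} → z ∈ xs → z ∈ ys) →
  length xs ≤ length ys
unique-length≤ []       ys _            _   = z≤n
unique-length≤ (x ∷ xs) ys (x∉xs ∷ uxs) sub =
  subst (suc (length xs) ≤_) (sym (length-remove ys x∈ys))
    (s≤s (unique-length≤ xs (remove ys x∈ys) uxs
      (λ z∈xs → ∈-remove ys x∈ys (sub (there z∈xs)) (λ z≡x → All.lookup x∉xs z∈xs (sym z≡x)))))
  where x∈ys = sub (here refl)

ind : Bool → ℕ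
ind b = if b then 1 else 0

count-as-sum : ∀ {A : Set} (p : A → Bool) xs → count p xs ≡ sumL (λ a → ind (p a)) xs
count-as-sum p []       = refl
count-as-sum p (a ∷ xs) with p a
... | true  = cong suc (count-as-sum p xs)
... | false = count-as-sum p xs

sumL-cong-∈ : ∀ {A : Set} (f g : A → ℕ) xs → (∀ {a} → a ∈ xs → f a ≡ g a) → sumL f xs ≡ sumL g xs
sumL-cong-∈ f g []       _ = refl
sumL-cong-∈ f g (a ∷ xs) h = cong₂ _+_ (h (here refl)) (sumL-cong-∈ f g xs (λ a∈xs → h (there a∈xs)))

sumL-cong : ∀ {A : Set} (f g : A → ℕ) xs → (∀ a → f a ≡ g a) → sumL f xs ≡ sumL g xs
sumL-cong f g xs h = sumL-cong-∈ f g xs (λ {a} _ → h a)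

sumL-zero : ∀ {A : Set} (f : A → ℕ) xs → (∀ {a} → a ∈ xs → f a ≡ 0) → sumL f xs ≡ 0
sumL-zero f xs h = trans (sumL-cong-∈ f (λ _ → 0) xs h) (sumL-zero-const xs)
  where
  sumL-zero-const : ∀ {A : Set} (xs : List A) → sumL (λ _ → 0) xs ≡ 0
  sumL-zero-const []       = refl
  sumL-zero-const (_ ∷ xs) = sumL-zero-const xs

sumL-+ : ∀ {A : Set} (f g : A → ℕ) xs → sumL (λ a → f a + g a) xs ≡ sumL f xs + sumL g xs
sumL-+ f g []       = refl
sumL-+ f g (a ∷ xs) rewrite sumL-+ f g xs = interchange (f a) (g a) (sumL f xs) (sumL g xs)
  where
  interchange : ∀ p q r t → p + q + (r + t) ≡ p + r + (q + t)
  interchange = solve-∀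

sumL-++ : ∀ {A : Set} (f : A → ℕ) xs ys → sumL f (xs ++ ys) ≡ sumL f xs + sumL f ys
sumL-++ f []       ys = refl
sumL-++ f (x ∷ xs) ys rewrite sumL-++ f xs ys = sym (+-assoc (f x) _ _)

sumL-map : ∀ {A B : Set} (f : B → ℕ) (g : A → B) xs → sumL f (map g xs) ≡ sumL (λ a → f (g a)) xs
sumL-map f g []       = refl
sumL-map f g (x ∷ xs) = cong (f (g x) +_) (sumL-map f g xs)

sumL-concatMap : ∀ {A B : Set} (f : B → ℕ) (g : A → List B) xs →
  sumL f (concatMap g xs) ≡ sumL (λ a → sumL f (g a)) xs
sumL-concatMap f g []       = refl
sumL-concatMap f g (x ∷ xs) =
  trans (sumL-++ f (g x) (concatMap g xs)) (cong (sumL f (g x) +_) (sumL-concatMap f g xs))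

sumL-swap : ∀ {A B : Set} (f : A → B → ℕ) xs ys →
  sumL (λ a → sumL (f a) ys) xs ≡ sumL (λ b → sumL (λ a → f a b) xs) ys
sumL-swap f []       ys = sym (sumL-zero _ ys (λ _ → refl))
sumL-swap f (x ∷ xs) ys =
  trans (cong (sumL (f x) ys +_) (sumL-swap f xs ys))
        (sym (sumL-+ (f x) (λ b → sumL (λ a → f a b) xs) ys))

sumL-*ʳ : ∀ {A : Set} (f : A → ℕ) xs c → sumL f xs * c ≡ sumL (λ a → f a * c) xs
sumL-*ʳ f []       c = refl
sumL-*ʳ f (x ∷ xs) c = trans (*-distribʳ-+ c (f x) (sumL f xs)) (cong (f x * c +_) (sumL-*ʳ f xs c))

sumL-select : ∀ {A : Set} (δ : A → Bool) (h : A → ℕ) {c} xs → Unique xs → c ∈ xs →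
  δ c ≡ true → (∀ {a} → a ≢ c → δ a ≡ false) →
  sumL (λ a → if δ a then h a else 0) xs ≡ h c
sumL-select δ h (c ∷ xs) (c∉xs ∷ _) (here refl) δc δ≢ rewrite δc =
  trans (cong (h c +_) (sumL-zero _ xs (λ a∈xs →
          cong (λ b → if b then h _ else 0) (δ≢ (λ a≡c → All.lookup c∉xs a∈xs (sym a≡c))))))
        (+-identityʳ (h c))
sumL-select δ h (x ∷ xs) (x∉xs ∷ uxs) (there c∈xs) δc δ≢
  rewrite δ≢ {x} (λ x≡c → All.lookup x∉xs c∈xs x≡c) = sumL-select δ h xs uxs c∈xs δc δ≢

sumL-pairs-∷ : ∀ {A : Set} (F : A × A → ℕ) x xs →
  sumL F (pairs (x ∷ xs)) ≡ sumL (λ b → F (x , b)) xs + sumL F (pairs xs)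
sumL-pairs-∷ F x xs = trans (sumL-++ F (map (x ,_) xs) (pairs xs)) (cong (_+ sumL F (pairs xs)) (sumL-map F (x ,_) xs))

pairs-++ : ∀ {A : Set} (F : A × A → ℕ) xs ys → sumL F (pairs (xs ++ ys)) ≡
  sumL F (pairs xs) + sumL (λ a → sumL (λ b → F (a , b)) ys) xs + sumL F (pairs ys)
pairs-++ F []       ys = refl
pairs-++ F (x ∷ xs) ys
  rewrite sumL-pairs-∷ F x (xs ++ ys) | sumL-++ (λ b → F (x , b)) xs ys | pairs-++ F xs ys | sumL-pairs-∷ F x xs = regroup (sumL (λ b → F (x , b)) xs) (sumL (λ b → F (x , b)) ys) (sumL F (pairs xs))
            (sumL (λ a → sumL (λ b → F (a , b)) ys) xs) (sumL F (pairs ys))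
  where
  regroup : ∀ a b P X Q → a + b + (P + X + Q) ≡ a + P + (b + X) + Q
  regroup = solve-∀

pairs-map : ∀ {A B : Set} (F : B × B → ℕ) (f : A → B) xs →
  sumL F (pairs (map f xs)) ≡ sumL (λ uv → F (f (proj₁ uv) , f (proj₂ uv))) (pairs xs)
pairs-map F f []       = refl
pairs-map F f (x ∷ xs)
  rewrite sumL-pairs-∷ F (f x) (map f xs) | sumL-map (λ b → F (f x , b)) f xs | pairs-map F f xs
        | sumL-pairs-∷ (λ uv → F (f (proj₁ uv) , f (proj₂ uv))) x xs = refl

firstTrue-least : ∀ (f : ℕ → Bool) i fuel j → f j ≡ true → i ≤ j → firstTrue f i fuel ≤ j
firstTrue-least f i zero       j fj i≤j = i≤j
firstTrue-least f i (suc fuel) j fj i≤j with f i in fi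
... | true  = i≤j
... | false with m≤n⇒m<n∨m≡n i≤j
...   | inj₁ i<j  = firstTrue-least f (suc i) fuel j fj i<j
...   | inj₂ refl with () ← trans (sym fi) fj

firstTrue-hit : ∀ (f : ℕ → Bool) i fuel j → f j ≡ true → i ≤ j → j ≤ i + fuel →
  f (firstTrue f i fuel) ≡ true
firstTrue-hit f i zero       j fj i≤j j≤i+0 =
  subst (λ n → f n ≡ true) (≤-antisym (subst (j ≤_) (+-identityʳ i) j≤i+0) i≤j) fj
firstTrue-hit f i (suc fuel) j fj i≤j j≤i+fuel with f i in fi
... | true  = fi
... | false with m≤n⇒m<n∨m≡n i≤j
...   | inj₁ i<j  = firstTrue-hit f (suc i) fuel j fj i<j (subst (j ≤_) (+-suc i fuel) j≤i+fuel)
...   | inj₂ refl with () ← trans (sym fi) fj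

module Walks (G : Graph) where

  data Walk : V G → V G → ℕ → Set where
    [] : ∀ {u} → Walk u u 0
    _∷_ : ∀ {u w v n} → adj G u w ≡ true → Walk w v n → Walk u v (suc n)

  infixr 5 _++ʷ_
  _++ʷ_ : ∀ {u v z n m} → Walk u v n → Walk v z m → Walk u z (n + m)
  []      ++ʷ w′ = w′
  (e ∷ w) ++ʷ w′ = e ∷ (w ++ʷ w′)

  Complete : Set
  Complete = ∀ v → v ∈ verts G

  Symmetric : Set
  Symmetric = ∀ u v → adj G u v ≡ true → adj G v u ≡ true

  reverse : Symmetric → ∀ {u v n} → Walk u v n → Walk v u n
  reverse sym-adj []                    = []
  reverse sym-adj (_∷_ {u} {w} {n = n} e walk) =
    subst (Walk _ u) (+-comm n 1) (reverse sym-adj walk ++ʷ (sym-adj u w e ∷ []))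

  reach-sound : ∀ m u v → reach G m u v ≡ true → ∃[ n ] (n ≤ m × Walk u v n)
  reach-sound zero    u v h with _≟_ G u v
  ... | yes refl = 0 , z≤n , []
  reach-sound (suc m) u v h with _≟_ G u v
  ... | yes refl = 0 , z≤n , []
  ... | no _ with any-witness (λ w → adj G u w ∧ reach G m w v) (verts G) h
  ...   | w , _ , e with ∧-true {adj G u w} e
  ...     | uw , wv with reach-sound m w v wv
  ...       | n , n≤m , walk = suc n , s≤s n≤m , uw ∷ walk

  reach-complete : Complete → ∀ {u v n} → Walk u v n → ∀ m → n ≤ m → reach G m u v ≡ true
  reach-complete complete {u} [] zero _ = isYes-refl (_≟_ G) u
  reach-complete complete {u} [] (suc m) _ rewrite isYes-refl (_≟_ G) u = refl
  reach-complete complete {u} {v} (_∷_ {w = w} e walk) (suc m) (s≤s n≤m) =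
    trans (cong (isYes (_≟_ G u v) ∨_)
            (any-intro (λ w′ → adj G u w′ ∧ reach G m w′ v) (complete w)
              (subst (λ b → (b ∧ reach G m w v) ≡ true) (sym e) (reach-complete complete walk m n≤m))))
          (∨-zeroʳ _)

  vertices : ∀ {u v n} → Walk u v n → List (V G)
  vertices {u} []       = u ∷ []
  vertices {u} (_ ∷ w)  = u ∷ vertices w

  vertices-length : ∀ {u v n} (w : Walk u v n) → length (vertices w) ≡ suc n
  vertices-length []      = refl
  vertices-length (_ ∷ w) = cong suc (vertices-length w)

  Path : V G → V G → Set
  Path u v = Σ ℕ λ n → Σ (Walk u v n) λ w → Unique (vertices w)

  path-suffix : ∀ {u v n z} (w : Walk u v n) → z ∈ vertices w → Unique (vertices w) → Path z v
  path-suffix []      (here refl) u-w = 0 , [] , u-w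
  path-suffix (e ∷ w) (here refl) u-w = _ , e ∷ w , u-w
  path-suffix (e ∷ w) (there z∈w) (_ ∷ u-w) = path-suffix w z∈w u-w

  -- every walk contains a path: cut out the cycle closed at a repeated vertex
  walk⇒path : ∀ {u v n} → Walk u v n → Path u v
  walk⇒path []          = 0 , [] , All.[] ∷ []
  walk⇒path {u} (e ∷ w) with walk⇒path w
  ... | m , p , u-p with DecMem._∈?_ (_≟_ G) u (vertices p)
  ...   | yes u∈p = path-suffix p u∈p u-p
  ...   | no  u∉p = suc m , e ∷ p , ¬Any⇒All¬ (vertices p) u∉p ∷ u-p

  shorten : Complete → ∀ {u v n} → Walk u v n → ∃[ m ] (m < length (verts G) × Walk u v m)
  shorten complete w with walk⇒path w
  ... | m , p , u-p =
    m , subst (_≤ length (verts G)) (vertices-length p)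
              (unique-length≤ (vertices p) (verts G) u-p (λ {z} _ → complete z)) , p

  dist-≤-walk : Complete → ∀ {u v n} → Walk u v n → dist G u v ≤ n
  dist-≤-walk complete {u} {v} {n} w =
    firstTrue-least (λ m → reach G m u v) 0 (length (verts G)) n (reach-complete complete w n ≤-refl) z≤n

  geodesic-of-walk : Complete → ∀ {u v n} → Walk u v n → Walk u v (dist G u v)
  geodesic-of-walk complete {u} {v} w with shorten complete w
  ... | m , m<N , short with reach-sound (dist G u v) u v
        (firstTrue-hit (λ q → reach G q u v) 0 (length (verts G)) m
          (reach-complete complete short m ≤-refl) z≤n (<⇒≤ m<N))
  ...   | n , n≤d , geo = subst (Walk u v) (≤-antisym n≤d (dist-≤-walk complete geo)) geo

  dist-of-shortest : Complete → ∀ {u v m} → Walk u v m → (∀ {n} → Walk u v n → m ≤ n) → dist G u v ≡ m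
  dist-of-shortest complete w shortest =
    ≤-antisym (dist-≤-walk complete w) (shortest (geodesic-of-walk complete w))

  dist-self : Complete → ∀ u → dist G u u ≡ 0
  dist-self complete u = n≤0⇒n≡0 (dist-≤-walk complete ([] {u}))

  module Geodesics (complete : Complete) (connected : Connected G) where

    geodesic : ∀ u v → Walk u v (dist G u v)
    geodesic u v with connected u v
    ... | m , h with reach-sound m u v h
    ...   | _ , _ , w = geodesic-of-walk complete w

    dist-edge : ∀ {a a′} c → adj G a a′ ≡ true → dist G a c ≤ suc (dist G a′ c)
    dist-edge c e = dist-≤-walk complete (e ∷ geodesic _ c)

    dist-sym : Symmetric → ∀ u v → dist G u v ≡ dist G v u
    dist-sym sym-adj u v = sym (dist-of-shortest complete (reverse sym-adj (geodesic u v))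
                                                   (λ w → dist-≤-walk complete (reverse sym-adj w)))

-- Generating polynomials.  genPoly f xs has as coefficient of t^c the number of
-- members a of xs with f a = c; a (closed) partial Hosoya polynomial is of this form,
-- and a double count of f a + m + g b is t^m times a product of two of them.

genPoly : ∀ {A : Set} → (A → ℕ) → List A → Poly
genPoly f xs c = count (λ a → f a ≡ᵇ c) xs

ind-* : ∀ b n → ind b * n ≡ (if b then n else 0)
ind-* true  n = +-identityʳ n
ind-* false n = refl

sum-upTo-select : ∀ v (h : ℕ → ℕ) e →
  (if v ≤ᵇ e then h v else 0) ≡ sumL (λ c → ind (v ≡ᵇ c) * h c) (upTo (suc e))
sum-upTo-select v h e =
  trans (selected (v ≤ᵇ e) refl) (sym (sumL-cong _ _ (upTo (suc e)) (λ c → ind-* (v ≡ᵇ c) (h c))))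
  where
  selected : ∀ b → (v ≤ᵇ e) ≡ b → (if b then h v else 0) ≡ sumL (λ c → if v ≡ᵇ c then h c else 0) (upTo (suc e))
  selected true  v≤e = sym (sumL-select (v ≡ᵇ_) h (upTo (suc e)) (upTo⁺ (suc e))
    (∈-upTo⁺ (s≤s (≤ᵇ⇒≤ v e (true-T v≤e)))) (≡ᵇ-true v v refl)
    (λ c≢v → ≡ᵇ-false v _ (λ v≡c → c≢v (sym v≡c))))
  selected false v≰e = sym (sumL-zero _ (upTo (suc e)) (λ {c} c∈ →
    cong (λ b → if b then h c else 0) (≡ᵇ-false v c (λ { refl →
      subst T v≰e (≤⇒≤ᵇ (≤-pred (∈-upTo⁻ c∈))) }))))

count-shifted : ∀ {B : Set} (g : B → ℕ) ys u e →
  sumL (λ b → ind (u + g b ≡ᵇ e)) ys ≡ (if u ≤ᵇ e then genPoly g ys (e ∸ u) else 0)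
count-shifted g ys u e with u ≤ᵇ e in u≤e
... | true = trans (sumL-cong _ _ ys (λ b → cong ind (T-ext
          (λ t → ≡⇒≡ᵇ (g b) (e ∸ u) (trans (sym (m+n∸m≡n u (g b))) (cong (_∸ u) (≡ᵇ⇒≡ _ _ t))))
          (λ t → ≡⇒≡ᵇ (u + g b) e
                   (trans (cong (u +_) (≡ᵇ⇒≡ _ _ t)) (m+[n∸m]≡n (≤ᵇ⇒≤ u e (true-T u≤e))))))))
               (sym (count-as-sum _ ys))
... | false = sumL-zero _ ys (λ {b} _ → cong ind (≡ᵇ-false (u + g b) e (λ u+g≡e →
          subst T u≤e (≤⇒≤ᵇ (subst (u ≤_) u+g≡e (m≤m+n u (g b)))))))

count-sum-pairs : ∀ {A B : Set} (f : A → ℕ) (g : B → ℕ) xs ys e →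
  sumL (λ a → sumL (λ b → ind (f a + g b ≡ᵇ e)) ys) xs ≡ (genPoly f xs ⊗ genPoly g ys) e
count-sum-pairs f g xs ys e = begin
  sumL (λ a → sumL (λ b → ind (f a + g b ≡ᵇ e)) ys) xs
    ≡⟨ sumL-cong _ _ xs (λ a → trans (count-shifted g ys (f a) e) (sum-upTo-select (f a) h e)) ⟩
  sumL (λ a → sumL (λ c → ind (f a ≡ᵇ c) * h c) (upTo (suc e))) xs
    ≡⟨ sumL-swap (λ a c → ind (f a ≡ᵇ c) * h c) xs (upTo (suc e)) ⟩
  sumL (λ c → sumL (λ a → ind (f a ≡ᵇ c) * h c) xs) (upTo (suc e))
    ≡⟨ sumL-cong _ _ (upTo (suc e)) (λ c →
         trans (sym (sumL-*ʳ (λ a → ind (f a ≡ᵇ c)) xs (h c))) (cong (_* h c) (sym (count-as-sum _ xs)))) ⟩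
  (genPoly f xs ⊗ genPoly g ys) e ∎
  where
  open ≡-Reasoning
  h : ℕ → ℕ
  h c = genPoly g ys (e ∸ c)

count-sum-pairs-offset : ∀ {A B : Set} (f : A → ℕ) (g : B → ℕ) xs ys m d →
  sumL (λ a → sumL (λ b → ind (f a + m + g b ≡ᵇ d)) ys) xs ≡ tpow* m (genPoly f xs ⊗ genPoly g ys) d
count-sum-pairs-offset f g xs ys m d with m ≤ᵇ d in m≤ᵇd
... | true = trans (sumL-cong _ _ xs (λ a → sumL-cong _ _ ys (λ b → cong ind (T-ext
                   (λ t → ≡⇒≡ᵇ _ _ (to a b (≡ᵇ⇒≡ _ _ t)))
                   (λ t → ≡⇒≡ᵇ _ _ (from a b (≡ᵇ⇒≡ _ _ t)))))))
                   (count-sum-pairs f g xs ys (d ∸ m))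
  where
  m≤d = ≤ᵇ⇒≤ m d (true-T m≤ᵇd)
  swap-last : ∀ p q r → p + q + r ≡ p + r + q
  swap-last = solve-∀
  reorder : ∀ a b → f a + m + g b ≡ f a + g b + m
  reorder a b = swap-last (f a) m (g b)
  to : ∀ a b → f a + m + g b ≡ d → f a + g b ≡ d ∸ m
  to a b eq = trans (sym (m+n∸n≡m (f a + g b) m)) (cong (_∸ m) (trans (sym (reorder a b)) eq))
  from : ∀ a b → f a + g b ≡ d ∸ m → f a + m + g b ≡ d
  from a b eq = trans (reorder a b) (trans (cong (_+ m) eq) (m∸n+n≡m m≤d))
... | false = sumL-zero _ xs (λ {a} _ → sumL-zero _ ys (λ {b} _ → cong ind (≡ᵇ-false _ d (λ eq →
                 subst T m≤ᵇd (≤⇒≤ᵇ (subst (m ≤_) eq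
                   (≤-trans (m≤n+m m (f a)) (m≤m+n (f a + m) (g b)))))))))

tpow*-⊗-cong : ∀ m {p p′ q q′ : Poly} → (∀ c → p c ≡ p′ c) → (∀ c → q c ≡ q′ c) →
  ∀ d → tpow* m (p ⊗ q) d ≡ tpow* m (p′ ⊗ q′) d
tpow*-⊗-cong m p≗p′ q≗q′ d =
  cong (λ n → if m ≤ᵇ d then n else 0) (sumL-cong _ _ (upTo (suc (d ∸ m))) (λ c → cong₂ _*_ (p≗p′ c) (q≗q′ (d ∸ m ∸ c))))

-- 1 + H_u(G) counts all vertices, u included, by their distance from u
closed-partial-Hosoya : (G : Graph) → WellFormed G → ∀ u c →
  (one ⊕ HosoyaAt G u) c ≡ genPoly (dist G u) (verts G) c
closed-partial-Hosoya G wf u c = sym (begin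
  genPoly (dist G u) (verts G) c
    ≡⟨ count-as-sum _ (verts G) ⟩
  sumL (λ a → ind (dist G u a ≡ᵇ c)) (verts G)
    ≡⟨ sumL-cong _ _ (verts G) split-at-u ⟩
  sumL (λ a → is-u a * one c + ind (not (isYes (u ≟G a)) ∧ (dist G u a ≡ᵇ c))) (verts G)
    ≡⟨ sumL-+ (λ a → is-u a * one c) _ (verts G) ⟩
  sumL (λ a → is-u a * one c) (verts G) + partial-coeff
    ≡⟨ cong (_+ partial-coeff) (trans (sym (sumL-*ʳ is-u (verts G) (one c)))
                                  (trans (cong (_* one c) u-once) (+-identityʳ (one c)))) ⟩
  one c + partial-coeff
    ≡⟨ cong (one c +_) (sym (count-as-sum _ (verts G))) ⟩
  (one ⊕ HosoyaAt G u) c ∎)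
  where
  open ≡-Reasoning
  _≟G_ = _≟_ G
  is-u : V G → ℕ
  is-u a = ind (isYes (u ≟G a))
  partial-coeff : ℕ
  partial-coeff = sumL (λ a → ind (not (isYes (u ≟G a)) ∧ (dist G u a ≡ᵇ c))) (verts G)
  u-once : sumL is-u (verts G) ≡ 1
  u-once = sumL-select (λ a → isYes (u ≟G a)) (λ _ → 1) (verts G) (proj₁ (proj₂ wf)) (proj₁ wf u)
             (isYes-refl _≟G_ u) (λ a≢u → isYes-false (λ u≡a → a≢u (sym u≡a)) (u ≟G _))
  -- the vertex u itself is the only one at distance 0 from u
  split-at-u : ∀ a → ind (dist G u a ≡ᵇ c) ≡ is-u a * one c + ind (not (isYes (u ≟G a)) ∧ (dist G u a ≡ᵇ c))
  split-at-u a with u ≟G a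
  ... | no _ = refl
  ... | yes refl rewrite Walks.dist-self G (proj₁ wf) u = one-at c
    where
    one-at : ∀ c → ind (0 ≡ᵇ c) ≡ 1 * one c + 0
    one-at zero    = refl
    one-at (suc _) = refl

between : ℕ → ℕ → ℕ → Bool
between a c l = (a <ᵇ l) ∧ (l <ᵇ c)

between-empty : ∀ a l → between a (suc a) l ≡ false
between-empty a l with a <ᵇ l in a<l
... | false = refl
... | true  = <ᵇ-false l (suc a) (λ l<1+a → <⇒≱ (<ᵇ⇒< a l (true-T a<l)) (≤-pred l<1+a))

between-split-left : ∀ a a′ c l v → a′ ≡ suc a → a′ < c →
  (if between a c l then v else 0) ≡ (if l ≡ᵇ a′ then v else 0) + (if between a′ c l then v else 0)
between-split-left a _ c l v refl a′<c with <-cmp l (suc a)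
... | tri< l<a′ l≢a′ _ rewrite <ᵇ-false a l (λ a<l → <⇒≱ a<l (≤-pred l<a′)) | ≡ᵇ-false l (suc a) l≢a′
                             | <ᵇ-false (suc a) l (<⇒≯ l<a′) = refl
... | tri≈ _ refl _ rewrite <ᵇ-true a (suc a) ≤-refl | <ᵇ-true (suc a) c a′<c | ≡ᵇ-true (suc a) (suc a) refl
                             | <ᵇ-false (suc a) (suc a) (<-irrefl refl) = sym (+-identityʳ v)
... | tri> _ l≢a′ a′<l rewrite <ᵇ-true a l (<-trans (n<1+n a) a′<l) | ≡ᵇ-false l (suc a) l≢a′
                             | <ᵇ-true (suc a) l a′<l = refl

between-split-right : ∀ a b b′ l v → b′ ≡ suc b → a < b →
  (if between a b′ l then v else 0) ≡ (if between a b l then v else 0) + (if l ≡ᵇ b then v else 0)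
between-split-right a b _ l v refl a<b with <-cmp l b
... | tri< l<b _ _ rewrite <ᵇ-true l (suc b) (m<n⇒m<1+n l<b) | <ᵇ-true l b l<b | ≡ᵇ-false l b (<⇒≢ l<b)
  with a <ᵇ l
...   | true  = sym (+-identityʳ v)
...   | false = refl
between-split-right a b _ l v refl a<b | tri≈ _ refl _
  rewrite <ᵇ-true a l a<b | <ᵇ-true l (suc l) ≤-refl | <ᵇ-false l l (<-irrefl refl) | ≡ᵇ-true l l refl = refl
between-split-right a b _ l v refl a<b | tri> _ _ b<l
  rewrite <ᵇ-true a l (<-trans a<b b<l) | <ᵇ-false l (suc b) (λ l<1+b → <⇒≱ b<l (≤-pred l<1+b))
        | <ᵇ-false l b (<⇒≯ b<l) | ≡ᵇ-false l b (λ l≡b → <⇒≢ b<l (sym l≡b)) = refl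

<-next : ∀ {a a′} → a′ ≡ suc a → a < a′
<-next refl = n<1+n _

nothing-between : ∀ {a a′ c} → a′ ≡ suc a → a < c → c < a′ → ⊥
nothing-between refl a<c c<1+a = <⇒≱ c<1+a a<c

∸-peel : ∀ a a′ c → a′ ≡ suc a → a′ ≤ c → c ∸ a ≡ suc (c ∸ a′)
∸-peel zero    _ (suc c) refl _         = refl
∸-peel (suc a) _ (suc c) refl (s≤s a<c) = ∸-peel a (suc a) c refl a<c

-- Its distances are given by an explicit formula
-- D: within a block D is the block distance, and from block i to a later block j
-- a shortest walk leaves G_i at y_i, crosses the bridge y_i x_{i+1} G_{i+1} … x_j
-- of length (j - i) + s_{i,j}, and continues inside G_j from x_j.
module Link (k : ℕ) (Gs : Fin k → Graph) (x y : (i : Fin k) → V (Gs i))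
            (wf : ∀ i → WellFormed (Gs i)) (conn : ∀ i → Connected (Gs i)) where

  L : Graph
  L = link k Gs x y

  Vertex : Set
  Vertex = LV k Gs x y

  module Block (i : Fin k) = Walks (Gs i)
  module BlockGeo (i : Fin k) = Walks.Geodesics (Gs i) (proj₁ (wf i)) (conn i)
  module WL = Walks L

  dG : (i : Fin k) → V (Gs i) → V (Gs i) → ℕ
  dG i = dist (Gs i)

  dG-self : ∀ i a → dG i a a ≡ 0
  dG-self i = Block.dist-self i (proj₁ (wf i))

  dG-sym : ∀ i a b → dG i a b ≡ dG i b a
  dG-sym i = BlockGeo.dist-sym i (λ u v e → trans (proj₁ (proj₂ (proj₂ (wf i))) v u) e)

  data Edge : Vertex → Vertex → Set where
    inside   : ∀ {i a b} → adj (Gs i) a b ≡ true → Edge (i , a) (i , b)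
    forward  : ∀ {i j} → toℕ j ≡ suc (toℕ i) → Edge (i , y i) (j , x j)
    backward : ∀ {i j} → toℕ i ≡ suc (toℕ j) → Edge (i , x i) (j , y j)

  edge-decode : ∀ {i a j b} → adj L (i , a) (j , b) ≡ true → Edge (i , a) (j , b)
  edge-decode {i} {a} {j} {b} h with i ≟F j
  ... | yes refl = inside h
  ... | no _ with ∨-true h
  ...   | inj₁ h₁ with ∧-true {toℕ j ≡ᵇ suc (toℕ i)} h₁
  ...     | j≡1+i , rest with ∧-true {isYes (_≟_ (Gs i) a (y i))} rest
  ...       | a≡y , b≡x = forward′ (≡ᵇ⇒≡ _ _ (true-T j≡1+i)) (isYes-true _ a≡y) (isYes-true _ b≡x)
    where
    forward′ : toℕ j ≡ suc (toℕ i) → a ≡ y i → b ≡ x j → Edge (i , a) (j , b)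
    forward′ e refl refl = forward e
  edge-decode {i} {a} {j} {b} h | no _ | inj₂ h₂ with ∧-true {toℕ i ≡ᵇ suc (toℕ j)} h₂
  ...     | i≡1+j , rest with ∧-true {isYes (_≟_ (Gs i) a (x i))} rest
  ...       | a≡x , b≡y = backward′ (≡ᵇ⇒≡ _ _ (true-T i≡1+j)) (isYes-true _ a≡x) (isYes-true _ b≡y)
    where
    backward′ : toℕ i ≡ suc (toℕ j) → a ≡ x i → b ≡ y j → Edge (i , a) (j , b)
    backward′ e refl refl = backward e

  edge-encode : ∀ {p q} → Edge p q → adj L p q ≡ true
  edge-encode (inside {i} e) with i ≟F i
  ... | yes refl = e
  ... | no i≢i   = ⊥-elim (i≢i refl)
  edge-encode (forward {i} {j} e) with i ≟F j
  ... | yes refl = ⊥-elim (1+n≢n (sym e))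
  ... | no _ rewrite ≡ᵇ-true _ _ e | isYes-refl (_≟_ (Gs i)) (y i) | isYes-refl (_≟_ (Gs j)) (x j) = refl
  edge-encode (backward {i} {j} e) with i ≟F j
  ... | yes refl = ⊥-elim (1+n≢n (sym e))
  ... | no _ rewrite ≡ᵇ-true _ _ e | isYes-refl (_≟_ (Gs i)) (x i) | isYes-refl (_≟_ (Gs j)) (y j) = ∨-zeroʳ _

  link-symmetric : WL.Symmetric
  link-symmetric (i , a) (j , b) h with edge-decode {i} {a} {j} {b} h
  ... | inside e   = edge-encode (inside (trans (proj₁ (proj₂ (proj₂ (wf i))) b a) e))
  ... | forward e  = edge-encode (backward e)
  ... | backward e = edge-encode (forward e)

  link-complete : WL.Complete
  link-complete (i , a) =
    ∈-concatMap⁺ (λ i → map (i ,_) (verts (Gs i))) (lose (∈-allFin i) (∈-map⁺ (i ,_) (proj₁ (wf i) a)))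

  embed : ∀ {i a b n} → Block.Walk i a b n → WL.Walk (i , a) (i , b) n
  embed Block.[]       = WL.[]
  embed (e Block.∷ w)  = edge-encode (inside e) WL.∷ embed w

  dxy : Fin k → ℕ
  dxy = dd k Gs x y

  sg : Fin k → Fin k → ℕ
  sg = s k Gs x y

  dxy-if : Bool → Fin k → ℕ
  dxy-if b l = if b then dxy l else 0

  sum-at : ∀ c → sumL (λ l → dxy-if (toℕ l ≡ᵇ toℕ c) l) (allFin k) ≡ dxy c
  sum-at c = sumL-select (λ l → toℕ l ≡ᵇ toℕ c) dxy (allFin k) (allFin⁺ k) (∈-allFin c)
               (≡ᵇ-true (toℕ c) _ refl) (λ l≢c → ≡ᵇ-false _ _ (λ eq → l≢c (toℕ-injective eq)))

  s-next : ∀ i j → toℕ j ≡ suc (toℕ i) → sg i j ≡ 0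
  s-next i j e = sumL-zero _ (allFin k) (λ {l} _ →
    cong (λ b → dxy-if b l) (trans (cong (λ c → between (toℕ i) c (toℕ l)) e) (between-empty (toℕ i) (toℕ l))))

  s-left : ∀ i i′ j → toℕ i′ ≡ suc (toℕ i) → toℕ i′ < toℕ j → sg i j ≡ dxy i′ + sg i′ j
  s-left i i′ j e i′<j = begin
    sg i j
      ≡⟨ sumL-cong _ _ (allFin k) (λ l → between-split-left (toℕ i) (toℕ i′) (toℕ j) (toℕ l) (dxy l) e i′<j) ⟩
    sumL (λ l → dxy-if (toℕ l ≡ᵇ toℕ i′) l + dxy-if (between (toℕ i′) (toℕ j) (toℕ l)) l) (allFin k)
      ≡⟨ sumL-+ (λ l → dxy-if (toℕ l ≡ᵇ toℕ i′) l) _ (allFin k) ⟩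
    sumL (λ l → dxy-if (toℕ l ≡ᵇ toℕ i′) l) (allFin k) + sg i′ j
      ≡⟨ cong (_+ sg i′ j) (sum-at i′) ⟩
    dxy i′ + sg i′ j ∎
    where open ≡-Reasoning

  s-right : ∀ i i′ j → toℕ i′ ≡ suc (toℕ i) → toℕ j < toℕ i → sg j i′ ≡ sg j i + dxy i
  s-right i i′ j e j<i = begin
    sg j i′
      ≡⟨ sumL-cong _ _ (allFin k) (λ l → between-split-right (toℕ j) (toℕ i) (toℕ i′) (toℕ l) (dxy l) e j<i) ⟩
    sumL (λ l → dxy-if (between (toℕ j) (toℕ i) (toℕ l)) l + dxy-if (toℕ l ≡ᵇ toℕ i) l) (allFin k)
      ≡⟨ sumL-+ _ (λ l → dxy-if (toℕ l ≡ᵇ toℕ i) l) (allFin k) ⟩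
    sg j i + sumL (λ l → dxy-if (toℕ l ≡ᵇ toℕ i) l) (allFin k)
      ≡⟨ cong (sg j i +_) (sum-at i) ⟩
    sg j i + dxy i ∎
    where open ≡-Reasoning

  -- the length (j - i) + s_{i,j} of the bridge from y_i to x_j, for i < j
  bridge : Fin k → Fin k → ℕ
  bridge i j = toℕ j ∸ toℕ i + sg i j

  bridge-next : ∀ i j → toℕ j ≡ suc (toℕ i) → bridge i j ≡ 1
  bridge-next i j e = cong₂ _+_ (trans (cong (_∸ toℕ i) e) (m+n∸n≡m 1 (toℕ i))) (s-next i j e)

  -- the bridge from y_i passes the edge y_i x_{i+1} and then G_{i+1} from x to y
  bridge-left : ∀ i i′ j → toℕ i′ ≡ suc (toℕ i) → toℕ i′ < toℕ j →
    bridge i j ≡ suc (dxy i′ + bridge i′ j)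
  bridge-left i i′ j e i′<j
    rewrite ∸-peel (toℕ i) (toℕ i′) (toℕ j) e (<⇒≤ i′<j) | s-left i i′ j e i′<j =
    shuffle (toℕ j ∸ toℕ i′) (dxy i′) (sg i′ j)
    where
    shuffle : ∀ J d S → suc J + (d + S) ≡ suc (d + (J + S))
    shuffle = solve-∀

  -- the bridge to x_{i+1} extends the bridge to x_i by G_i and the edge y_i x_{i+1}
  bridge-right : ∀ i i′ j → toℕ i′ ≡ suc (toℕ i) → toℕ j < toℕ i →
    bridge j i′ ≡ suc (bridge j i + dxy i)
  bridge-right i i′ j e j<i =
    trans (cong₂ _+_ (trans (cong (_∸ toℕ j) e) (+-∸-assoc 1 (<⇒≤ j<i))) (s-right i i′ j e j<i))
          (cong suc (sym (+-assoc (toℕ i ∸ toℕ j) (sg j i) (dxy i))))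

  D : Vertex → Vertex → ℕ
  D (i , a) (j , b) with <-cmpF i j
  ... | tri< _ _ _    = dG i a (y i) + bridge i j + dG j (x j) b
  ... | tri≈ _ refl _ = dG i a b
  ... | tri> _ _ _    = dG i a (x i) + bridge j i + dG j (y j) b

  D-< : ∀ i a j b → toℕ i < toℕ j → D (i , a) (j , b) ≡ dG i a (y i) + bridge i j + dG j (x j) b
  D-< i a j b i<j with <-cmpF i j
  ... | tri< _ _ _    = refl
  ... | tri≈ _ refl _ = ⊥-elim (<-irrefl refl i<j)
  ... | tri> _ _ j<i  = ⊥-elim (<-asym i<j j<i)

  D-≡ : ∀ i a b → D (i , a) (i , b) ≡ dG i a b
  D-≡ i a b with <-cmpF i i
  ... | tri< i<i _ _  = ⊥-elim (<-irrefl refl i<i)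
  ... | tri≈ _ refl _ = refl
  ... | tri> _ _ i<i  = ⊥-elim (<-irrefl refl i<i)

  D-> : ∀ i a j b → toℕ j < toℕ i → D (i , a) (j , b) ≡ dG i a (x i) + bridge j i + dG j (y j) b
  D-> i a j b j<i with <-cmpF i j
  ... | tri< i<j _ _  = ⊥-elim (<-asym i<j j<i)
  ... | tri≈ _ refl _ = ⊥-elim (<-irrefl refl j<i)
  ... | tri> _ _ _    = refl

  D-step-inside : ∀ {i a a′} q → adj (Gs i) a a′ ≡ true → D (i , a) q ≤ suc (D (i , a′) q)
  D-step-inside {i} {a} {a′} (j , b) e with <-cmpF i j
  ... | tri< _ _ _    = +-monoˡ-≤ _ (+-monoˡ-≤ _ (BlockGeo.dist-edge i (y i) e))
  ... | tri≈ _ refl _ = BlockGeo.dist-edge i b e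
  ... | tri> _ _ _    = +-monoˡ-≤ _ (+-monoˡ-≤ _ (BlockGeo.dist-edge i (x i) e))

  D-step-forward : ∀ {i i′} q → toℕ i′ ≡ suc (toℕ i) → D (i , y i) q ≤ suc (D (i′ , x i′) q)
  D-step-forward {i} {i′} (j , b) e with <-cmpF i j
  D-step-forward {i} {i′} (j , b) e | tri< i<j _ _ with <-cmpF i′ j
  ... | tri< i′<j _ _ rewrite dG-self i (y i) | bridge-left i i′ j e i′<j = ≤-refl
  ... | tri≈ _ refl _ rewrite dG-self i (y i) | bridge-next i i′ e = ≤-refl
  ... | tri> _ _ j<i′ = ⊥-elim (nothing-between e i<j j<i′)
  D-step-forward {i} {i′} (j , b) e | tri≈ _ refl _
    rewrite D-> i′ (x i′) i b (<-next e) | dG-self i′ (x i′)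
          | bridge-next i i′ e = m≤n+m _ 2
  D-step-forward {i} {i′} (j , b) e | tri> _ _ j<i
    rewrite D-> i′ (x i′) j b (<-trans j<i (<-next e)) | dG-self i′ (x i′)
          | bridge-right i i′ j e j<i | dG-sym i (y i) (x i) =
    ≤-trans (≤-reflexive (commute (dxy i) (bridge j i) (dG j (y j) b))) (m≤n+m _ 2)
    where
    commute : ∀ d B c → d + B + c ≡ B + d + c
    commute = solve-∀

  D-step-backward : ∀ {i i′} q → toℕ i′ ≡ suc (toℕ i) → D (i′ , x i′) q ≤ suc (D (i , y i) q)
  D-step-backward {i} {i′} (j , b) e with <-cmpF i′ j
  D-step-backward {i} {i′} (j , b) e | tri< i′<j _ _
    rewrite D-< i (y i) j b (<-trans (<-next e) i′<j)
          | dG-self i (y i) | bridge-left i i′ j e i′<j = m≤n+m _ 2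
  D-step-backward {i} {i′} (j , b) e | tri≈ _ refl _
    rewrite D-< i (y i) i′ b (<-next e) | dG-self i (y i)
          | bridge-next i i′ e = m≤n+m _ 2
  D-step-backward {i} {i′} (j , b) e | tri> _ _ j<i′ with <-cmpF i j
  ... | tri< i<j _ _ = ⊥-elim (nothing-between e i<j j<i′)
  ... | tri≈ _ refl _ rewrite dG-self i′ (x i′) | bridge-next i i′ e = ≤-refl
  ... | tri> _ _ j<i rewrite dG-self i′ (x i′) | bridge-right i i′ j e j<i | dG-sym i (y i) (x i) =
    ≤-reflexive (cong suc (commute (bridge j i) (dxy i) (dG j (y j) b)))
    where
    commute : ∀ B d c → B + d + c ≡ d + B + c
    commute = solve-∀

  D-step : ∀ {p p′} q → Edge p p′ → D p q ≤ suc (D p′ q)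
  D-step q (inside e)   = D-step-inside q e
  D-step q (forward e)  = D-step-forward q e
  D-step q (backward e) = D-step-backward q e

  D-≤-walk : ∀ {p q n} → WL.Walk p q n → D p q ≤ n
  D-≤-walk (WL.[] {j , b}) = ≤-reflexive (trans (D-≡ j b b) (dG-self j b))
  D-≤-walk (WL._∷_ {i , a} {j , c} {q} e w) =
    ≤-trans (D-step q (edge-decode {i} {a} {j} {c} e)) (s≤s (D-≤-walk w))

  -- the bridge is realised by a walk: forward edges alternating with geodesics
  -- from x to y in the intermediate blocks (induction on j - i - 1)
  bridge-walk′ : ∀ n i j → toℕ j ≡ suc (n + toℕ i) → WL.Walk (i , y i) (j , x j) (bridge i j)
  bridge-walk′ zero i j e =
    subst (WL.Walk (i , y i) (j , x j)) (sym (bridge-next i j e)) (edge-encode (forward e) WL.∷ WL.[])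
  bridge-walk′ (suc n) i j e =
    subst (WL.Walk (i , y i) (j , x j)) (sym (bridge-left i i′ j i′≡1+i i′<j))
      (edge-encode (forward i′≡1+i) WL.∷ (embed (BlockGeo.geodesic i′ (x i′) (y i′)) WL.++ʷ rest))
    where
    1+i<j : suc (toℕ i) < toℕ j
    1+i<j = subst (suc (toℕ i) <_) (sym e) (s≤s (s≤s (m≤n+m (toℕ i) n)))
    i′ : Fin k
    i′ = fromℕ< (<-trans 1+i<j (toℕ<n j))
    i′≡1+i : toℕ i′ ≡ suc (toℕ i)
    i′≡1+i = toℕ-fromℕ< _
    i′<j : toℕ i′ < toℕ j
    i′<j = subst (_< toℕ j) (sym i′≡1+i) 1+i<j
    rest : WL.Walk (i′ , y i′) (j , x j) (bridge i′ j)
    rest = bridge-walk′ n i′ j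
      (trans e (cong suc (trans (sym (+-suc n (toℕ i))) (cong (n +_) (sym i′≡1+i)))))

  bridge-walk : ∀ i j → toℕ i < toℕ j → WL.Walk (i , y i) (j , x j) (bridge i j)
  bridge-walk i j i<j = bridge-walk′ (toℕ j ∸ suc (toℕ i)) i j
    (sym (trans (sym (+-suc (toℕ j ∸ suc (toℕ i)) (toℕ i))) (m∸n+n≡m i<j)))

  walk-across : ∀ i a j b → toℕ i < toℕ j →
    WL.Walk (i , a) (j , b) (dG i a (y i) + bridge i j + dG j (x j) b)
  walk-across i a j b i<j = subst (WL.Walk (i , a) (j , b)) (sym (+-assoc (dG i a (y i)) _ _))
    (embed (BlockGeo.geodesic i a (y i)) WL.++ʷ bridge-walk i j i<j WL.++ʷ embed (BlockGeo.geodesic j (x j) b))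

  D-walk : ∀ p q → WL.Walk p q (D p q)
  D-walk (i , a) (j , b) with <-cmpF i j
  ... | tri< i<j _ _  = walk-across i a j b i<j
  ... | tri≈ _ refl _ = embed (BlockGeo.geodesic i a b)
  ... | tri> _ _ j<i  =
    subst (WL.Walk (i , a) (j , b)) reversed-length (WL.reverse link-symmetric (walk-across j b i a j<i))
    where
    reversed-length : dG j b (y j) + bridge j i + dG i (x i) a ≡ dG i a (x i) + bridge j i + dG j (y j) b
    reversed-length rewrite dG-sym j b (y j) | dG-sym i (x i) a =
      outer-swap (dG j (y j) b) (bridge j i) (dG i a (x i))
      where
      outer-swap : ∀ A M B → A + M + B ≡ B + M + A
      outer-swap = solve-∀

  -- distances in the link: D bounds every walk from below and is attained
  dist-link : ∀ p q → dist L p q ≡ D p q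
  dist-link p q = WL.dist-of-shortest link-complete (D-walk p q) D-≤-walk

  -- Pairs inside a block give H(G_i); a pair in
  -- blocks i < j is at distance d(a , y_i) + bridge i j + d(x_j , b), which is
  -- counted by the cross term of the formula.
  module Coefficient (d : ℕ) where

    block : Fin k → List Vertex
    block i = map (i ,_) (verts (Gs i))

    atDist : Vertex × Vertex → ℕ
    atDist pq = ind (dist L (proj₁ pq) (proj₂ pq) ≡ᵇ d)

    cross : Fin k × Fin k → ℕ
    cross ij = tpow* (bridge (proj₁ ij) (proj₂ ij))
                 ((one ⊕ HosoyaAt (Gs (proj₁ ij)) (y (proj₁ ij))) ⊗
                  (one ⊕ HosoyaAt (Gs (proj₂ ij)) (x (proj₂ ij)))) d

    within-block : ∀ i → sumL atDist (pairs (block i)) ≡ Hosoya (Gs i) d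
    within-block i = begin
      sumL atDist (pairs (block i))
        ≡⟨ pairs-map atDist (i ,_) (verts (Gs i)) ⟩
      sumL (λ ab → atDist ((i , proj₁ ab) , (i , proj₂ ab))) (pairs (verts (Gs i)))
        ≡⟨ sumL-cong _ _ (pairs (verts (Gs i)))
             (λ ab → cong (λ n → ind (n ≡ᵇ d)) (trans (dist-link _ _) (D-≡ i _ _))) ⟩
      sumL (λ ab → ind (dG i (proj₁ ab) (proj₂ ab) ≡ᵇ d)) (pairs (verts (Gs i)))
        ≡⟨ sym (count-as-sum _ (pairs (verts (Gs i)))) ⟩
      Hosoya (Gs i) d ∎
      where open ≡-Reasoning

    between-blocks : ∀ i j → toℕ i < toℕ j →
      sumL (λ a → sumL (λ b → atDist ((i , a) , (j , b))) (verts (Gs j))) (verts (Gs i)) ≡ cross (i , j)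
    between-blocks i j i<j = begin
      sumL (λ a → sumL (λ b → atDist ((i , a) , (j , b))) (verts (Gs j))) (verts (Gs i))
        ≡⟨ sumL-cong _ _ (verts (Gs i)) (λ a → sumL-cong _ _ (verts (Gs j)) (λ b →
             cong (λ n → ind (n ≡ᵇ d)) (trans (dist-link _ _) (trans (D-< i a j b i<j)
               (cong (λ n → n + bridge i j + dG j (x j) b) (dG-sym i a (y i))))))) ⟩
      sumL (λ a → sumL (λ b → ind (dG i (y i) a + bridge i j + dG j (x j) b ≡ᵇ d)) (verts (Gs j))) (verts (Gs i))
        ≡⟨ count-sum-pairs-offset (dG i (y i)) (dG j (x j)) (verts (Gs i)) (verts (Gs j)) (bridge i j) d ⟩
      tpow* (bridge i j) (genPoly (dG i (y i)) (verts (Gs i)) ⊗ genPoly (dG j (x j)) (verts (Gs j))) d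
        ≡⟨ tpow*-⊗-cong (bridge i j) (λ c → sym (closed-partial-Hosoya (Gs i) (wf i) (y i) c))
                                     (λ c → sym (closed-partial-Hosoya (Gs j) (wf j) (x j) c)) d ⟩
      cross (i , j) ∎
      where open ≡-Reasoning

    from-block : ∀ i js → All.All (i <F_) js →
      sumL (λ p → sumL (λ q → atDist (p , q)) (concatMap block js)) (block i) ≡ sumL (λ j → cross (i , j)) js
    from-block i js i<js = begin
      sumL (λ p → sumL (λ q → atDist (p , q)) (concatMap block js)) (block i)
        ≡⟨ sumL-map (λ p → sumL (λ q → atDist (p , q)) (concatMap block js)) (i ,_) (verts (Gs i)) ⟩
      sumL (λ a → sumL (λ q → atDist ((i , a) , q)) (concatMap block js)) (verts (Gs i))
        ≡⟨ sumL-cong _ _ (verts (Gs i)) (λ a → trans (sumL-concatMap _ block js)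
             (sumL-cong _ _ js (λ j → sumL-map (λ q → atDist ((i , a) , q)) (j ,_) (verts (Gs j))))) ⟩
      sumL (λ a → sumL (λ j → sumL (λ b → atDist ((i , a) , (j , b))) (verts (Gs j))) js) (verts (Gs i))
        ≡⟨ sumL-swap (λ a j → sumL (λ b → atDist ((i , a) , (j , b))) (verts (Gs j))) (verts (Gs i)) js ⟩
      sumL (λ j → sumL (λ a → sumL (λ b → atDist ((i , a) , (j , b))) (verts (Gs j))) (verts (Gs i))) js
        ≡⟨ sumL-cong-∈ _ _ js (λ j∈js → between-blocks i _ (All.lookup i<js j∈js)) ⟩
      sumL (λ j → cross (i , j)) js ∎
      where open ≡-Reasoning

    blockTerms : List (Fin k) → ℕ
    blockTerms is = sumL (λ i → Hosoya (Gs i) d) is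

    over-blocks : ∀ is → AllPairs _<F_ is →
      sumL atDist (pairs (concatMap block is)) ≡ blockTerms is + sumL cross (pairs is)
    over-blocks []       []            = refl
    over-blocks (i ∷ is) (i<is ∷ incr) = begin
      sumL atDist (pairs (block i ++ concatMap block is))
        ≡⟨ pairs-++ atDist (block i) (concatMap block is) ⟩
      sumL atDist (pairs (block i)) + sumL (λ p → sumL (λ q → atDist (p , q)) (concatMap block is)) (block i)
        + sumL atDist (pairs (concatMap block is))
        ≡⟨ cong₂ _+_ (cong₂ _+_ (within-block i) (from-block i is i<is)) (over-blocks is incr) ⟩
      Hosoya (Gs i) d + sumL (λ j → cross (i , j)) is + (blockTerms is + sumL cross (pairs is))
        ≡⟨ interchange (Hosoya (Gs i) d) _ _ _ ⟩
      blockTerms (i ∷ is) + (sumL (λ j → cross (i , j)) is + sumL cross (pairs is))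
        ≡⟨ cong (blockTerms (i ∷ is) +_) (sym (sumL-pairs-∷ cross i is)) ⟩
      blockTerms (i ∷ is) + sumL cross (pairs (i ∷ is)) ∎
      where
      open ≡-Reasoning
      interchange : ∀ H C Hs Cs → H + C + (Hs + Cs) ≡ H + Hs + (C + Cs)
      interchange = solve-∀

    allFin-increasing : AllPairs _<F_ (allFin k)
    allFin-increasing = tabulate⁺-< (λ i<j → i<j)

mainTheorem5 : (k : ℕ) (Gs : Fin k → Graph) (x y : (i : Fin k) → V (Gs i)) →
    (∀ i → WellFormed (Gs i)) → (∀ i → Connected (Gs i)) →
    ∀ d → Hosoya (link k Gs x y) d ≡ linkRHS k Gs x y d
mainTheorem5 k Gs x y wf conn d = begin
  Hosoya (link k Gs x y) d
    ≡⟨ count-as-sum _ (pairs (verts L)) ⟩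
  sumL atDist (pairs (concatMap block (allFin k)))
    ≡⟨ over-blocks (allFin k) allFin-increasing ⟩
  linkRHS k Gs x y d ∎
  where
  open ≡-Reasoning
  open Link k Gs x y wf conn
  open Coefficient d
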